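{- For every positive integer $n$, \[ \sum_{r\ge 0}U_{2r+1}(2n-1)\frac{z^{2r+1}}{(2r+1)!} = n\binom{2n}{n}\sum_{0 \le j \le k < n} \frac{(-1)^{k-j}\binom{n-1}{k}\binom{2k}{k-j}}{\binom{2k}{k}}\, \frac{\sinh\left(\left(j+\frac12\right)z\right)}{j+k+1}. \]
   Context: For $r\in\mathbb{N}$ and $n\in\mathbb{Z}$ define \[ U_r(n) = \sum_{k\in\mathbb{Z}} \binom{n}{k}\left|\frac{n}{2}-k\right|^r, \] where $0^0=1$, and for $n\ge0$ the binomial coefficient $\binom{n}{k}$ is $0$ if $k<0$ or $k>n$ and $\frac{n!}{(n-k)!\,k!}$ otherwise. -}

module Defs where

open import Data.Nat as ℕ using (ℕ; zero; suc; _∸_)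
open import Data.Nat.Combinatorics using (_C_)
open import Data.Integer as ℤ using (ℤ; +_)
open import Data.Rational using (ℚ; 0ℚ; 1ℚ; _+_; _*_; _-_; -_; ∣_∣; _/_)

_^_ : ℚ → ℕ → ℚ
p ^ zero  = 1ℚ
p ^ suc m = p * (p ^ m)

ι : ℕ → ℚ
ι m = + m / 1

Σ< : ℕ → (ℕ → ℚ) → ℚ
Σ< zero    f = 0ℚ
Σ< (suc n) f = Σ< n f + f n

-- division by a natural number (only used with positive denominators)
_÷ℕ_ : ℚ → ℕ → ℚ
p ÷ℕ zero  = 0ℚ
p ÷ℕ suc d = p * (+ 1 / suc d)

sgn : ℕ → ℚ
sgn m = (- 1ℚ) ^ m

-- U_r(N) = Σ_k binom(N,k) |N/2 - k|^r  for N ≥ 0 (terms with k ∉ [0,N] vanish)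
U : ℕ → ℕ → ℚ
U r N = Σ< (suc N) (λ k → ι (N C k) * (∣ (+ N / 2) - ι k ∣ ^ r))

-- Coefficient of z^(2r+1)/(2r+1)! on the right-hand side, using
-- sinh(a z) = Σ_r a^(2r+1) z^(2r+1)/(2r+1)!
rhsCoeff : ℕ → ℕ → ℚ
rhsCoeff n r =
  ι (n ℕ.* ((2 ℕ.* n) C n)) *
  Σ< n (λ k → Σ< (suc k) (λ j →
    ((sgn (k ∸ j) * ι ((n ∸ 1) C k) * ι ((2 ℕ.* k) C (k ∸ j)))
       ÷ℕ ((2 ℕ.* k) C k))
    * (((ι j + (+ 1 / 2)) ^ (2 ℕ.* r ℕ.+ 1)) ÷ℕ (j ℕ.+ k ℕ.+ 1))))

-- For N = 2n - 1 the distance |N/2 - k| is j + ½ exactly for k = n - 1 - j and k = n + j, so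
-- U_e(N) = Σ_{j<n} 2 C(2n-1, n-1-j) (j + ½)^e for every e.  On the right-hand side, exchanging the two
-- sums and putting k = j + i, p = n - 1 - j, the coefficient of (j + ½)^(2r+1) becomes
-- (n-1)!/p! · Σ_{i≤p} (-1)^i C(p,i) (j+i)!/(2j+i+1)!.  The alternating sum is a p-th finite difference
-- of x ↦ x!/(x+j+1)!, and since Δ(x!/(x+e)!) = -e x!/(x+e+1)! it equals (j+p)!/(2j+p+1)!; with the
-- prefactor n C(2n, n) the coefficient becomes 2 C(2n-1, p).

module Submission where

open import Defs
open import Data.Nat as ℕ using (ℕ; zero; suc; _∸_; _!; NonZero)
import Data.Nat.Properties as ℕₚ
open import Data.Nat.DivMod using (m/n*n≡m)
open import Data.Nat.Combinatorics
  using (_C_; nCk≡n!/k![n-k]!; k![n∸k]!∣n!; nCk≡nC[n∸k]; k>n⇒nCk≡0; nCk+nC[k+1]≡[n+1]C[k+1])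
import Data.Nat.Tactic.RingSolver as ℕ-Solver
open import Data.Integer as ℤ using (+_)
import Data.Integer.Properties as ℤ
import Data.Integer.Tactic.RingSolver as ℤ-Solver
open import Data.Rational using (ℚ; 0ℚ; 1ℚ; _+_; _*_; _-_; -_; ∣_∣; _/_; _≤_; fromℚᵘ)
import Data.Rational.Properties as ℚ
import Data.Rational.Unnormalised as ℚᵘ
import Data.Rational.Unnormalised.Properties as ℚᵘ
open import Data.Maybe using (Maybe)
open import Relation.Nullary.Decidable using (dec⇒maybe)
open import Tactic.RingSolver using (solve-∀)
import Tactic.RingSolver.Core.AlmostCommutativeRing as ACR
open import Relation.Binary.PropositionalEquality
open ≡-Reasoning

ℚ-ring : ACR.AlmostCommutativeRing _ _
ℚ-ring = ACR.fromCommutativeRing ℚ.+-*-commutativeRing 0≟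
  where
  0≟ : ∀ p → Maybe (0ℚ ≡ p)
  0≟ p = dec⇒maybe (0ℚ ℚ.≟ p)

fromℚᵘ-homo-+ : ∀ p q → fromℚᵘ (p ℚᵘ.+ q) ≡ fromℚᵘ p + fromℚᵘ q
fromℚᵘ-homo-+ p q = ℚ.toℚᵘ-injective (ℚᵘ.≃-trans (ℚ.toℚᵘ-fromℚᵘ (p ℚᵘ.+ q))
  (ℚᵘ.≃-trans (ℚᵘ.+-cong (ℚᵘ.≃-sym (ℚ.toℚᵘ-fromℚᵘ p)) (ℚᵘ.≃-sym (ℚ.toℚᵘ-fromℚᵘ q)))
    (ℚᵘ.≃-sym (ℚ.toℚᵘ-homo-+ (fromℚᵘ p) (fromℚᵘ q)))))

fromℚᵘ-homo-* : ∀ p q → fromℚᵘ (p ℚᵘ.* q) ≡ fromℚᵘ p * fromℚᵘ q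
fromℚᵘ-homo-* p q = ℚ.toℚᵘ-injective (ℚᵘ.≃-trans (ℚ.toℚᵘ-fromℚᵘ (p ℚᵘ.* q))
  (ℚᵘ.≃-trans (ℚᵘ.*-cong (ℚᵘ.≃-sym (ℚ.toℚᵘ-fromℚᵘ p)) (ℚᵘ.≃-sym (ℚ.toℚᵘ-fromℚᵘ q)))
    (ℚᵘ.≃-sym (ℚ.toℚᵘ-homo-* (fromℚᵘ p) (fromℚᵘ q)))))

-- ι m is definitionally fromℚᵘ of the unnormalised rational m/1.
ι-homo-+ : ∀ m n → ι (m ℕ.+ n) ≡ ι m + ι n
ι-homo-+ m n =
  trans (ℚ.fromℚᵘ-cong {ℚᵘ.mkℚᵘ (+ (m ℕ.+ n)) 0} {ℚᵘ.mkℚᵘ (+ m) 0 ℚᵘ.+ ℚᵘ.mkℚᵘ (+ n) 0}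
           (ℚᵘ.*≡* (trans (cong (ℤ._* + 1) (ℤ.pos-+ m n)) (cross (+ m) (+ n)))))
        (fromℚᵘ-homo-+ (ℚᵘ.mkℚᵘ (+ m) 0) (ℚᵘ.mkℚᵘ (+ n) 0))
  where
  cross : ∀ x y → (x ℤ.+ y) ℤ.* + 1 ≡ (x ℤ.* + 1 ℤ.+ y ℤ.* + 1) ℤ.* + 1
  cross = ℤ-Solver.solve-∀

ι-homo-* : ∀ m n → ι (m ℕ.* n) ≡ ι m * ι n
ι-homo-* m n =
  trans (ℚ.fromℚᵘ-cong {ℚᵘ.mkℚᵘ (+ (m ℕ.* n)) 0} {ℚᵘ.mkℚᵘ (+ m) 0 ℚᵘ.* ℚᵘ.mkℚᵘ (+ n) 0}
           (ℚᵘ.*≡* (cong (ℤ._* + 1) (ℤ.pos-* m n))))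
        (fromℚᵘ-homo-* (ℚᵘ.mkℚᵘ (+ m) 0) (ℚᵘ.mkℚᵘ (+ n) 0))

½ : ℚ
½ = + 1 / 2

½+½≡1 : ½ + ½ ≡ 1ℚ
½+½≡1 = refl

[1+m+m]/2≡ι[m]+½ : ∀ m → + (suc m ℕ.+ m) / 2 ≡ ι m + ½
[1+m+m]/2≡ι[m]+½ m =
  trans (ℚ.fromℚᵘ-cong {ℚᵘ.mkℚᵘ (+ (suc m ℕ.+ m)) 1} {ℚᵘ.mkℚᵘ (+ m) 0 ℚᵘ.+ ℚᵘ.mkℚᵘ (+ 1) 1}
           (ℚᵘ.*≡* (trans (cong (ℤ._* + 2) (ℤ.pos-+ (suc m) m)) (cross (+ m)))))
        (fromℚᵘ-homo-+ (ℚᵘ.mkℚᵘ (+ m) 0) (ℚᵘ.mkℚᵘ (+ 1) 1))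
  where
  cross : ∀ x → (+ 1 ℤ.+ x ℤ.+ x) ℤ.* + 2 ≡ (x ℤ.* + 2 ℤ.+ + 1 ℤ.* + 1) ℤ.* + 2
  cross = ℤ-Solver.solve-∀

-- recip 0 = 0, matching the junk value of _÷ℕ_.
recip : ℕ → ℚ
recip zero    = 0ℚ
recip (suc d) = + 1 / suc d

÷ℕ≡*recip : ∀ p d → p ÷ℕ d ≡ p * recip d
÷ℕ≡*recip p zero    = sym (ℚ.*-zeroʳ p)
÷ℕ≡*recip p (suc d) = refl

ι*recip≡1 : ∀ d .{{_ : NonZero d}} → ι d * recip d ≡ 1ℚ
ι*recip≡1 (suc d) =
  trans (sym (fromℚᵘ-homo-* (ℚᵘ.mkℚᵘ (+ suc d) 0) (ℚᵘ.mkℚᵘ (+ 1) d)))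
        (ℚ.fromℚᵘ-cong {ℚᵘ.mkℚᵘ (+ suc d) 0 ℚᵘ.* ℚᵘ.mkℚᵘ (+ 1) d} {ℚᵘ.mkℚᵘ (+ 1) 0}
           (ℚᵘ.*≡* (cross (+ suc d))))
  where
  cross : ∀ x → (x ℤ.* + 1) ℤ.* + 1 ≡ + 1 ℤ.* (+ 1 ℤ.* x)
  cross = ℤ-Solver.solve-∀

recip-homo-* : ∀ a b .{{_ : NonZero a}} .{{_ : NonZero b}} → recip (a ℕ.* b) ≡ recip a * recip b
recip-homo-* a b = begin
  recip (a ℕ.* b)                                          ≡⟨ sym (ℚ.*-identityˡ _) ⟩
  1ℚ * recip (a ℕ.* b)                                     ≡⟨ cong (_* recip (a ℕ.* b)) (sym (cong₂ _*_ (ι*recip≡1 a) (ι*recip≡1 b))) ⟩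
  (ι a * recip a) * (ι b * recip b) * recip (a ℕ.* b)     ≡⟨ regroup (ι a) (recip a) (ι b) (recip b) (recip (a ℕ.* b)) ⟩
  (recip a * recip b) * ((ι a * ι b) * recip (a ℕ.* b))   ≡⟨ cong (λ x → (recip a * recip b) * (x * recip (a ℕ.* b))) (sym (ι-homo-* a b)) ⟩
  (recip a * recip b) * (ι (a ℕ.* b) * recip (a ℕ.* b))   ≡⟨ cong ((recip a * recip b) *_) (ι*recip≡1 (a ℕ.* b) {{ℕₚ.m*n≢0 a b}}) ⟩
  (recip a * recip b) * 1ℚ                                 ≡⟨ ℚ.*-identityʳ _ ⟩
  recip a * recip b                                        ∎
  where
  regroup : ∀ x x′ y y′ z → (x * x′) * (y * y′) * z ≡ (x′ * y′) * ((x * y) * z)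
  regroup = solve-∀ ℚ-ring

ι*recip-cross : ∀ a b c d .{{_ : NonZero b}} .{{_ : NonZero d}} →
                a ℕ.* d ≡ c ℕ.* b → ι a * recip b ≡ ι c * recip d
ι*recip-cross a b c d ad≡cb = begin
  ι a * recip b                           ≡⟨ sym (ℚ.*-identityʳ _) ⟩
  ι a * recip b * 1ℚ                      ≡⟨ cong (ι a * recip b *_) (sym (ι*recip≡1 d)) ⟩
  ι a * recip b * (ι d * recip d)         ≡⟨ regroup (ι a) (recip b) (ι d) (recip d) ⟩
  ι a * ι d * (recip b * recip d)         ≡⟨ cong (_* (recip b * recip d)) (sym (ι-homo-* a d)) ⟩
  ι (a ℕ.* d) * (recip b * recip d)       ≡⟨ cong (λ x → ι x * (recip b * recip d)) ad≡cb ⟩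
  ι (c ℕ.* b) * (recip b * recip d)       ≡⟨ cong (_* (recip b * recip d)) (ι-homo-* c b) ⟩
  ι c * ι b * (recip b * recip d)         ≡⟨ regroup′ (ι c) (ι b) (recip b) (recip d) ⟩
  ι c * recip d * (ι b * recip b)         ≡⟨ cong (ι c * recip d *_) (ι*recip≡1 b) ⟩
  ι c * recip d * 1ℚ                      ≡⟨ ℚ.*-identityʳ _ ⟩
  ι c * recip d                           ∎
  where
  regroup : ∀ w x y z → w * x * (y * z) ≡ w * y * (x * z)
  regroup = solve-∀ ℚ-ring
  regroup′ : ∀ w x y z → w * x * (y * z) ≡ w * z * (x * y)
  regroup′ = solve-∀ ℚ-ring

Σ<-cong : ∀ n {f g : ℕ → ℚ} → (∀ i → i ℕ.< n → f i ≡ g i) → Σ< n f ≡ Σ< n g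
Σ<-cong zero    f≗g = refl
Σ<-cong (suc n) f≗g = cong₂ _+_ (Σ<-cong n (λ i i<n → f≗g i (ℕₚ.m<n⇒m<1+n i<n))) (f≗g n (ℕₚ.n<1+n n))

Σ<-+ : ∀ n (f g : ℕ → ℚ) → Σ< n (λ i → f i + g i) ≡ Σ< n f + Σ< n g
Σ<-+ zero    f g = refl
Σ<-+ (suc n) f g = trans (cong (_+ (f n + g n)) (Σ<-+ n f g)) (interchange (Σ< n f) (Σ< n g) (f n) (g n))
  where
  interchange : ∀ a b c d → (a + b) + (c + d) ≡ (a + c) + (b + d)
  interchange = solve-∀ ℚ-ring

Σ<-- : ∀ n (f g : ℕ → ℚ) → Σ< n (λ i → f i - g i) ≡ Σ< n f - Σ< n g
Σ<-- zero    f g = refl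
Σ<-- (suc n) f g = trans (cong (_+ (f n - g n)) (Σ<-- n f g)) (interchange (Σ< n f) (Σ< n g) (f n) (g n))
  where
  interchange : ∀ a b c d → (a - b) + (c - d) ≡ (a + c) - (b + d)
  interchange = solve-∀ ℚ-ring

Σ<-*ˡ : ∀ n c (f : ℕ → ℚ) → Σ< n (λ i → c * f i) ≡ c * Σ< n f
Σ<-*ˡ zero    c f = sym (ℚ.*-zeroʳ c)
Σ<-*ˡ (suc n) c f = trans (cong (_+ c * f n) (Σ<-*ˡ n c f)) (sym (ℚ.*-distribˡ-+ c (Σ< n f) (f n)))

Σ<-head : ∀ n (f : ℕ → ℚ) → Σ< (suc n) f ≡ f 0 + Σ< n (λ i → f (suc i))
Σ<-head zero    f = trans (ℚ.+-identityˡ (f 0)) (sym (ℚ.+-identityʳ (f 0)))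
Σ<-head (suc n) f = trans (cong (_+ f (suc n)) (Σ<-head n f)) (ℚ.+-assoc (f 0) _ _)

Σ<-split : ∀ a b (f : ℕ → ℚ) → Σ< (a ℕ.+ b) f ≡ Σ< a f + Σ< b (λ i → f (a ℕ.+ i))
Σ<-split a zero    f = trans (cong (λ n → Σ< n f) (ℕₚ.+-identityʳ a)) (sym (ℚ.+-identityʳ _))
Σ<-split a (suc b) f = begin
  Σ< (a ℕ.+ suc b) f                                   ≡⟨ cong (λ n → Σ< n f) (ℕₚ.+-suc a b) ⟩
  Σ< (a ℕ.+ b) f + f (a ℕ.+ b)                         ≡⟨ cong (_+ f (a ℕ.+ b)) (Σ<-split a b f) ⟩
  Σ< a f + Σ< b (λ i → f (a ℕ.+ i)) + f (a ℕ.+ b)     ≡⟨ ℚ.+-assoc (Σ< a f) _ _ ⟩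
  Σ< a f + Σ< (suc b) (λ i → f (a ℕ.+ i))             ∎

Σ<-reverse : ∀ n (f : ℕ → ℚ) → Σ< (suc n) f ≡ Σ< (suc n) (λ i → f (n ∸ i))
Σ<-reverse zero    f = refl
Σ<-reverse (suc n) f = begin
  Σ< (suc n) f + f (suc n)                          ≡⟨ cong (_+ f (suc n)) (Σ<-reverse n f) ⟩
  Σ< (suc n) (λ i → f (n ∸ i)) + f (suc n)          ≡⟨ ℚ.+-comm _ (f (suc n)) ⟩
  f (suc n) + Σ< (suc n) (λ i → f (n ∸ i))          ≡⟨ sym (Σ<-head (suc n) (λ i → f (suc n ∸ i))) ⟩
  Σ< (suc (suc n)) (λ i → f (suc n ∸ i))            ∎

Σ<-triangle : ∀ n (g : ℕ → ℕ → ℚ) →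
  Σ< n (λ k → Σ< (suc k) (g k)) ≡ Σ< n (λ j → Σ< (n ∸ j) (λ i → g (j ℕ.+ i) j))
Σ<-triangle zero    g = refl
Σ<-triangle (suc n) g = begin
  Σ< n (λ k → Σ< (suc k) (g k)) + Σ< (suc n) (g n)     ≡⟨ cong (_+ Σ< (suc n) (g n)) (Σ<-triangle n g) ⟩
  Σ< n column + Σ< (suc n) (g n)                        ≡⟨ cong (_+ Σ< (suc n) (g n)) (sym (ℚ.+-identityʳ (Σ< n column))) ⟩
  Σ< n column + 0ℚ + Σ< (suc n) (g n)                   ≡⟨ cong (λ m → Σ< n column + Σ< m (λ i → g (n ℕ.+ i) n) + Σ< (suc n) (g n)) (sym (ℕₚ.n∸n≡0 n)) ⟩
  Σ< (suc n) column + Σ< (suc n) (g n)                  ≡⟨ sym (Σ<-+ (suc n) column (g n)) ⟩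
  Σ< (suc n) (λ j → column j + g n j)                   ≡⟨ Σ<-cong (suc n) extend ⟩
  Σ< (suc n) (λ j → Σ< (suc n ∸ j) (λ i → g (j ℕ.+ i) j)) ∎
  where
  column : ℕ → ℚ
  column j = Σ< (n ∸ j) (λ i → g (j ℕ.+ i) j)
  extend : ∀ j → j ℕ.< suc n → column j + g n j ≡ Σ< (suc n ∸ j) (λ i → g (j ℕ.+ i) j)
  extend j (ℕ.s≤s j≤n) = begin
    column j + g n j                                 ≡⟨ cong (λ k → column j + g k j) (sym (ℕₚ.m+[n∸m]≡n j≤n)) ⟩
    Σ< (suc (n ∸ j)) (λ i → g (j ℕ.+ i) j)          ≡⟨ cong (λ m → Σ< m (λ i → g (j ℕ.+ i) j)) (sym (ℕₚ.+-∸-assoc 1 j≤n)) ⟩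
    Σ< (suc n ∸ j) (λ i → g (j ℕ.+ i) j)            ∎

kCm*[m!*n!]≡k! : ∀ {k} m n → m ℕ.+ n ≡ k → (k C m) ℕ.* (m ! ℕ.* n !) ≡ k !
kCm*[m!*n!]≡k! m n refl =
  trans (cong (λ k → ((m ℕ.+ n) C m) ℕ.* (m ! ℕ.* k !)) (sym (ℕₚ.m+n∸m≡n m n)))
    (trans (cong (ℕ._* (m ! ℕ.* (m ℕ.+ n ∸ m) !)) (nCk≡n!/k![n-k]! m≤m+n))
           (m/n*n≡m {{m !* (m ℕ.+ n ∸ m) !≢0}} (k![n∸k]!∣n! m≤m+n)))
  where
  m≤m+n = ℕₚ.m≤m+n m n
  open ℕₚ using (_!*_!≢0)

kCm≢0 : ∀ {k} m n → m ℕ.+ n ≡ k → NonZero (k C m)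
kCm≢0 {k} m n m+n≡k = ℕₚ.m*n≢0⇒m≢0 (k C m) {{subst NonZero (sym (kCm*[m!*n!]≡k! m n m+n≡k)) (k !≢0)}}
  where open ℕₚ using (_!≢0)

n+n≡2*n : ∀ n → n ℕ.+ n ≡ 2 ℕ.* n
n+n≡2*n n = cong (n ℕ.+_) (sym (ℕₚ.+-identityʳ n))

rising : ℕ → ℕ → ℕ
rising d zero    = 1
rising d (suc p) = d ℕ.* rising (suc d) p

rising*!≡! : ∀ j p → rising (suc j) p ℕ.* j ! ≡ (j ℕ.+ p) !
rising*!≡! j zero    = trans (ℕₚ.+-identityʳ (j !)) (cong _! (sym (ℕₚ.+-identityʳ j)))
rising*!≡! j (suc p) = begin
  suc j ℕ.* rising (suc (suc j)) p ℕ.* j !   ≡⟨ swap (suc j) (rising (suc (suc j)) p) (j !) ⟩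
  rising (suc (suc j)) p ℕ.* (suc j) !        ≡⟨ rising*!≡! (suc j) p ⟩
  (suc j ℕ.+ p) !                             ≡⟨ cong _! (sym (ℕₚ.+-suc j p)) ⟩
  (j ℕ.+ suc p) !                             ∎
  where
  swap : ∀ a b c → a ℕ.* b ℕ.* c ≡ b ℕ.* (a ℕ.* c)
  swap = ℕ-Solver.solve-∀

factorialRatio : ℕ → ℕ → ℚ
factorialRatio e x = ι (x !) * recip ((x ℕ.+ e) !)

recip[k!]≡ι[1+k]*recip[[1+k]!] : ∀ k → recip (k !) ≡ ι (suc k) * recip (suc k !)
recip[k!]≡ι[1+k]*recip[[1+k]!] k =
  trans (sym (ℚ.*-identityˡ _))
        (ι*recip-cross 1 (k !) (suc k) (suc k !) {{k !≢0}} {{suc k !≢0}} (ℕₚ.*-identityˡ (suc k !)))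
  where open ℕₚ using (_!≢0)

factorialRatio-difference : ∀ e x →
  factorialRatio e x - factorialRatio e (suc x) ≡ ι e * factorialRatio (suc e) x
factorialRatio-difference e x = begin
  ι (x !) * recip ((x ℕ.+ e) !) - ι (suc x !) * R
    ≡⟨ cong (λ r → ι (x !) * r - ι (suc x !) * R) (recip[k!]≡ι[1+k]*recip[[1+k]!] (x ℕ.+ e)) ⟩
  ι (x !) * (ι (suc (x ℕ.+ e)) * R) - ι (suc x ℕ.* x !) * R
    ≡⟨ cong₂ (λ a b → ι (x !) * (a * R) - b * R)
             (trans (ι-homo-+ 1 (x ℕ.+ e)) (cong (λ y → 1ℚ + y) (ι-homo-+ x e)))
             (trans (ι-homo-* (suc x) (x !)) (cong (_* ι (x !)) (ι-homo-+ 1 x))) ⟩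
  ι (x !) * ((1ℚ + (ι x + ι e)) * R) - ((1ℚ + ι x) * ι (x !)) * R
    ≡⟨ cancel (ι (x !)) (ι x) (ι e) R ⟩
  ι e * (ι (x !) * R)
    ≡⟨ cong (λ k → ι e * (ι (x !) * recip (k !))) (sym (ℕₚ.+-suc x e)) ⟩
  ι e * factorialRatio (suc e) x
    ∎
  where
  R = recip (suc (x ℕ.+ e) !)
  cancel : ∀ f y c q → f * ((1ℚ + (y + c)) * q) - ((1ℚ + y) * f) * q ≡ c * (f * q)
  cancel = solve-∀ ℚ-ring

-- (-1)^p times the p-th forward difference of f at 0.
alternatingBinomialSum : ℕ → (ℕ → ℚ) → ℚ
alternatingBinomialSum p f = Σ< (suc p) (λ i → sgn i * ι (p C i) * f i)

alternatingBinomialSum-cong : ∀ p {f g : ℕ → ℚ} → (∀ i → f i ≡ g i) →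
  alternatingBinomialSum p f ≡ alternatingBinomialSum p g
alternatingBinomialSum-cong p f≗g = Σ<-cong (suc p) (λ i _ → cong (sgn i * ι (p C i) *_) (f≗g i))

alternatingBinomialSum-*ˡ : ∀ p c (f : ℕ → ℚ) →
  alternatingBinomialSum p (λ i → c * f i) ≡ c * alternatingBinomialSum p f
alternatingBinomialSum-*ˡ p c f =
  trans (Σ<-cong (suc p) (λ i _ → swap (sgn i) (ι (p C i)) c (f i))) (Σ<-*ˡ (suc p) c _)
  where
  swap : ∀ s b c x → s * b * (c * x) ≡ c * (s * b * x)
  swap = solve-∀ ℚ-ring

alternatingBinomialSum-suc : ∀ p (f : ℕ → ℚ) →
  alternatingBinomialSum (suc p) f ≡ alternatingBinomialSum p (λ i → f i - f (suc i))
alternatingBinomialSum-suc p f = begin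
  Σ< (suc (suc p)) h                                       ≡⟨ Σ<-head (suc p) h ⟩
  a 0 + Σ< (suc p) (λ i → h (suc i))                       ≡⟨ cong (λ y → a 0 + y) (Σ<-cong (suc p) (λ i _ → pascal i)) ⟩
  a 0 + Σ< (suc p) (λ i → a (suc i) - b i)                 ≡⟨ cong (λ y → a 0 + y) (Σ<-- (suc p) (λ i → a (suc i)) b) ⟩
  a 0 + (Σ< (suc p) (λ i → a (suc i)) - Σ< (suc p) b)      ≡⟨ sym (ℚ.+-assoc (a 0) _ _) ⟩
  a 0 + Σ< (suc p) (λ i → a (suc i)) - Σ< (suc p) b        ≡⟨ cong (_- Σ< (suc p) b) (sym (Σ<-head (suc p) a)) ⟩
  Σ< (suc p) a + a (suc p) - Σ< (suc p) b                  ≡⟨ cong (λ c → Σ< (suc p) a + sgn (suc p) * ι c * f (suc p) - Σ< (suc p) b)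
                                                                    (k>n⇒nCk≡0 (ℕₚ.n<1+n p)) ⟩
  Σ< (suc p) a + sgn (suc p) * 0ℚ * f (suc p) - Σ< (suc p) b ≡⟨ dropZero (Σ< (suc p) a) (sgn (suc p)) (f (suc p)) (Σ< (suc p) b) ⟩
  Σ< (suc p) a - Σ< (suc p) b                              ≡⟨ sym (Σ<-- (suc p) a b) ⟩
  Σ< (suc p) (λ i → a i - b i)                             ≡⟨ Σ<-cong (suc p) (λ i _ → sym (*-distribˡ-- (sgn i * ι (p C i)) (f i) (f (suc i)))) ⟩
  alternatingBinomialSum p (λ i → f i - f (suc i))         ∎
  where
  h a b : ℕ → ℚ
  h i = sgn i * ι (suc p C i) * f i
  a i = sgn i * ι (p C i) * f i
  b i = sgn i * ι (p C i) * f (suc i)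
  pascal : ∀ i → h (suc i) ≡ a (suc i) - b i
  pascal i = begin
    - 1ℚ * sgn i * ι (suc p C suc i) * f (suc i)                   ≡⟨ cong (λ c → - 1ℚ * sgn i * ι c * f (suc i)) (sym (nCk+nC[k+1]≡[n+1]C[k+1] p i)) ⟩
    - 1ℚ * sgn i * ι (p C i ℕ.+ p C suc i) * f (suc i)            ≡⟨ cong (λ c → - 1ℚ * sgn i * c * f (suc i)) (ι-homo-+ (p C i) (p C suc i)) ⟩
    - 1ℚ * sgn i * (ι (p C i) + ι (p C suc i)) * f (suc i)        ≡⟨ split (sgn i) (ι (p C i)) (ι (p C suc i)) (f (suc i)) ⟩
    - 1ℚ * sgn i * ι (p C suc i) * f (suc i) - b i                 ∎
    where
    split : ∀ s c c′ x → - 1ℚ * s * (c + c′) * x ≡ - 1ℚ * s * c′ * x - s * c * x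
    split = solve-∀ ℚ-ring
  dropZero : ∀ x s y z → x + s * 0ℚ * y - z ≡ x - z
  dropZero = solve-∀ ℚ-ring
  *-distribˡ-- : ∀ c x y → c * (x - y) ≡ c * x - c * y
  *-distribˡ-- = solve-∀ ℚ-ring

alternatingBinomialSum-factorialRatio : ∀ p d x →
  alternatingBinomialSum p (λ i → factorialRatio d (x ℕ.+ i)) ≡ ι (rising d p) * factorialRatio (d ℕ.+ p) x
alternatingBinomialSum-factorialRatio zero d x =
  trans (unit (factorialRatio d (x ℕ.+ 0)))
        (cong₂ (λ e y → 1ℚ * factorialRatio e y) (sym (ℕₚ.+-identityʳ d)) (ℕₚ.+-identityʳ x))
  where
  unit : ∀ g → 0ℚ + 1ℚ * 1ℚ * g ≡ 1ℚ * g
  unit = solve-∀ ℚ-ring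
alternatingBinomialSum-factorialRatio (suc p) d x = begin
  alternatingBinomialSum (suc p) (λ i → factorialRatio d (x ℕ.+ i))
    ≡⟨ alternatingBinomialSum-suc p _ ⟩
  alternatingBinomialSum p (λ i → factorialRatio d (x ℕ.+ i) - factorialRatio d (x ℕ.+ suc i))
    ≡⟨ alternatingBinomialSum-cong p difference ⟩
  alternatingBinomialSum p (λ i → ι d * factorialRatio (suc d) (x ℕ.+ i))
    ≡⟨ alternatingBinomialSum-*ˡ p (ι d) _ ⟩
  ι d * alternatingBinomialSum p (λ i → factorialRatio (suc d) (x ℕ.+ i))
    ≡⟨ cong (ι d *_) (alternatingBinomialSum-factorialRatio p (suc d) x) ⟩
  ι d * (ι (rising (suc d) p) * factorialRatio (suc d ℕ.+ p) x)
    ≡⟨ sym (ℚ.*-assoc (ι d) _ _) ⟩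
  ι d * ι (rising (suc d) p) * factorialRatio (suc d ℕ.+ p) x
    ≡⟨ cong₂ _*_ (sym (ι-homo-* d _)) (cong (λ e → factorialRatio e x) (sym (ℕₚ.+-suc d p))) ⟩
  ι (rising d (suc p)) * factorialRatio (d ℕ.+ suc p) x
    ∎
  where
  difference : ∀ i → factorialRatio d (x ℕ.+ i) - factorialRatio d (x ℕ.+ suc i)
                     ≡ ι d * factorialRatio (suc d) (x ℕ.+ i)
  difference i = trans (cong (λ y → factorialRatio d (x ℕ.+ i) - factorialRatio d y) (ℕₚ.+-suc x i))
                       (factorialRatio-difference d (x ℕ.+ i))

-- The summand of rhsCoeff (suc m) r, apart from the factor (j + ½)^(2r+1) / (j + k + 1).
rhsTerm : ℕ → ℕ → ℕ → ℚ
rhsTerm m k j = (sgn (k ∸ j) * ι (m C k) * ι ((2 ℕ.* k) C (k ∸ j))) ÷ℕ ((2 ℕ.* k) C k)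

-- With t = j + i, s = j + t and p = i + q, this is the identity
-- C(j+p, t) C(2t, i) / (C(2t, t) (s+1)) = (j+p)!/p! · C(p, i) · t!/(s+1)!
-- with denominators cleared; multiplying by t! q! i! s! turns both sides into (j+p)! p! (2t)! (s+1)!.
rhsTerm-cleared : ∀ j i q →
  (((j ℕ.+ (i ℕ.+ q)) C (j ℕ.+ i)) ℕ.* ((2 ℕ.* (j ℕ.+ i)) C i)) ℕ.* ((i ℕ.+ q) ! ℕ.* (j ℕ.+ i ℕ.+ suc j) !)
  ≡ ((j ℕ.+ (i ℕ.+ q)) ! ℕ.* ((i ℕ.+ q) C i) ℕ.* (j ℕ.+ i) !) ℕ.* (((2 ℕ.* (j ℕ.+ i)) C (j ℕ.+ i)) ℕ.* suc (j ℕ.+ (j ℕ.+ i)))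
rhsTerm-cleared j i q = ℕₚ.*-cancelʳ-≡ _ _ Z {{ℕₚ.m*n≢0 _ _ {{t !* q !≢0}} {{i !* s !≢0}}}} (trans lhs (sym rhs))
  where
  open ℕₚ using (_!*_!≢0)
  t = j ℕ.+ i
  s = j ℕ.+ t
  p = i ℕ.+ q
  M = j ℕ.+ p
  Z = (t ! ℕ.* q !) ℕ.* (i ! ℕ.* s !)
  i+s≡2t : i ℕ.+ s ≡ 2 ℕ.* t
  i+s≡2t = eq j i
    where
    eq : ∀ j i → i ℕ.+ (j ℕ.+ (j ℕ.+ i)) ≡ 2 ℕ.* (j ℕ.+ i)
    eq = ℕ-Solver.solve-∀
  t+[1+j]≡1+s : t ℕ.+ suc j ≡ suc s
  t+[1+j]≡1+s = eq j i
    where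
    eq : ∀ j i → j ℕ.+ i ℕ.+ suc j ≡ suc (j ℕ.+ (j ℕ.+ i))
    eq = ℕ-Solver.solve-∀
  lhs : ((M C t) ℕ.* ((2 ℕ.* t) C i)) ℕ.* (p ! ℕ.* (t ℕ.+ suc j) !) ℕ.* Z ≡ M ! ℕ.* p ! ℕ.* (2 ℕ.* t) ! ℕ.* suc s !
  lhs = begin
    ((M C t) ℕ.* ((2 ℕ.* t) C i)) ℕ.* (p ! ℕ.* (t ℕ.+ suc j) !) ℕ.* Z
      ≡⟨ regroup (M C t) ((2 ℕ.* t) C i) (p !) ((t ℕ.+ suc j) !) (t !) (q !) (i !) (s !) ⟩
    ((M C t) ℕ.* (t ! ℕ.* q !)) ℕ.* p ! ℕ.* (((2 ℕ.* t) C i) ℕ.* (i ! ℕ.* s !)) ℕ.* (t ℕ.+ suc j) !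
      ≡⟨ cong₂ (λ a b → a ℕ.* p ! ℕ.* b ℕ.* (t ℕ.+ suc j) !) (kCm*[m!*n!]≡k! t q (ℕₚ.+-assoc j i q)) (kCm*[m!*n!]≡k! i s i+s≡2t) ⟩
    M ! ℕ.* p ! ℕ.* (2 ℕ.* t) ! ℕ.* (t ℕ.+ suc j) !
      ≡⟨ cong (λ n → M ! ℕ.* p ! ℕ.* (2 ℕ.* t) ! ℕ.* n !) t+[1+j]≡1+s ⟩
    M ! ℕ.* p ! ℕ.* (2 ℕ.* t) ! ℕ.* suc s !
      ∎
    where
    regroup : ∀ a b c d tf qf if sf →
      (a ℕ.* b) ℕ.* (c ℕ.* d) ℕ.* ((tf ℕ.* qf) ℕ.* (if ℕ.* sf)) ≡ (a ℕ.* (tf ℕ.* qf)) ℕ.* c ℕ.* (b ℕ.* (if ℕ.* sf)) ℕ.* d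
    regroup = ℕ-Solver.solve-∀
  rhs : (M ! ℕ.* (p C i) ℕ.* t !) ℕ.* (((2 ℕ.* t) C t) ℕ.* suc s) ℕ.* Z ≡ M ! ℕ.* p ! ℕ.* (2 ℕ.* t) ! ℕ.* suc s !
  rhs = begin
    (M ! ℕ.* (p C i) ℕ.* t !) ℕ.* (((2 ℕ.* t) C t) ℕ.* suc s) ℕ.* Z
      ≡⟨ regroup (M !) (p C i) ((2 ℕ.* t) C t) (suc s) (t !) (q !) (i !) (s !) ⟩
    M ! ℕ.* ((p C i) ℕ.* (i ! ℕ.* q !)) ℕ.* (((2 ℕ.* t) C t) ℕ.* (t ! ℕ.* t !)) ℕ.* (suc s ℕ.* s !)
      ≡⟨ cong₂ (λ a b → M ! ℕ.* a ℕ.* b ℕ.* suc s !) (kCm*[m!*n!]≡k! i q refl) (kCm*[m!*n!]≡k! t t (n+n≡2*n t)) ⟩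
    M ! ℕ.* p ! ℕ.* (2 ℕ.* t) ! ℕ.* suc s !
      ∎
    where
    regroup : ∀ a b c d tf qf if sf →
      (a ℕ.* b ℕ.* tf) ℕ.* (c ℕ.* d) ℕ.* ((tf ℕ.* qf) ℕ.* (if ℕ.* sf)) ≡ a ℕ.* (b ℕ.* (if ℕ.* qf)) ℕ.* (c ℕ.* (tf ℕ.* tf)) ℕ.* (d ℕ.* sf)
    regroup = ℕ-Solver.solve-∀

rhsTerm-reindexed : ∀ j i q {p} → i ℕ.+ q ≡ p →
  rhsTerm (j ℕ.+ p) (j ℕ.+ i) j * recip (j ℕ.+ (j ℕ.+ i) ℕ.+ 1)
  ≡ (ι ((j ℕ.+ p) !) * recip (p !)) * (sgn i * ι (p C i) * factorialRatio (suc j) (j ℕ.+ i))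
rhsTerm-reindexed j i q refl = begin
  rhsTerm M t j * recip (s ℕ.+ 1)
    ≡⟨ cong₂ _*_ (÷ℕ≡*recip _ Cc) (cong recip (ℕₚ.+-comm s 1)) ⟩
  sgn (t ∸ j) * ι (M C t) * ι ((2 ℕ.* t) C (t ∸ j)) * recip Cc * recip (suc s)
    ≡⟨ cong (λ k → sgn k * ι (M C t) * ι ((2 ℕ.* t) C k) * recip Cc * recip (suc s)) (ℕₚ.m+n∸m≡n j i) ⟩
  sgn i * ι (M C t) * ι ((2 ℕ.* t) C i) * recip Cc * recip (suc s)
    ≡⟨ regroup₁ (sgn i) (ι (M C t)) (ι ((2 ℕ.* t) C i)) (recip Cc) (recip (suc s)) ⟩
  sgn i * (ι (M C t) * ι ((2 ℕ.* t) C i) * (recip Cc * recip (suc s)))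
    ≡⟨ cong₂ (λ a b → sgn i * (a * b)) (sym (ι-homo-* (M C t) _)) (sym (recip-homo-* Cc (suc s))) ⟩
  sgn i * (ι ((M C t) ℕ.* ((2 ℕ.* t) C i)) * recip (Cc ℕ.* suc s))
    ≡⟨ cong (sgn i *_) (ι*recip-cross ((M C t) ℕ.* ((2 ℕ.* t) C i)) (Cc ℕ.* suc s)
                                       (M ! ℕ.* (p C i) ℕ.* t !) (p ! ℕ.* (t ℕ.+ suc j) !)
                                       {{ℕₚ.m*n≢0 Cc (suc s)}} {{p !* (t ℕ.+ suc j) !≢0}}
                                       (rhsTerm-cleared j i q)) ⟩
  sgn i * (ι (M ! ℕ.* (p C i) ℕ.* t !) * recip (p ! ℕ.* (t ℕ.+ suc j) !))
    ≡⟨ cong₂ (λ a b → sgn i * (a * b))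
             (trans (ι-homo-* (M ! ℕ.* (p C i)) (t !)) (cong (_* ι (t !)) (ι-homo-* (M !) (p C i))))
             (recip-homo-* (p !) ((t ℕ.+ suc j) !) {{p !≢0}} {{(t ℕ.+ suc j) !≢0}}) ⟩
  sgn i * (ι (M !) * ι (p C i) * ι (t !) * (recip (p !) * recip ((t ℕ.+ suc j) !)))
    ≡⟨ regroup₂ (sgn i) (ι (M !)) (ι (p C i)) (ι (t !)) (recip (p !)) (recip ((t ℕ.+ suc j) !)) ⟩
  (ι (M !) * recip (p !)) * (sgn i * ι (p C i) * factorialRatio (suc j) t)
    ∎
  where
  open ℕₚ using (_!≢0; _!*_!≢0)
  t = j ℕ.+ i
  s = j ℕ.+ t
  p = i ℕ.+ q
  M = j ℕ.+ p
  Cc = (2 ℕ.* t) C t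
  instance
    Cc≢0 : NonZero Cc
    Cc≢0 = kCm≢0 t t (n+n≡2*n t)
  regroup₁ : ∀ σ a b x y → σ * a * b * x * y ≡ σ * (a * b * (x * y))
  regroup₁ = solve-∀ ℚ-ring
  regroup₂ : ∀ σ a b c x y → σ * (a * b * c * (x * y)) ≡ (a * x) * (σ * b * (c * y))
  regroup₂ = solve-∀ ℚ-ring

-- Multiplying either side by n = j + p + 1 gives (2n)!.
centralBinomial-cleared : ∀ j p → let M = j ℕ.+ p ; Y = j ℕ.+ (suc j ℕ.+ p) in
  suc M ℕ.* ((2 ℕ.* suc M) C suc M) ℕ.* M ! ℕ.* M ! ℕ.* 1 ≡ 2 ℕ.* ((suc M ℕ.+ M) C p) ℕ.* (p ! ℕ.* Y !)
centralBinomial-cleared j p = ℕₚ.*-cancelʳ-≡ _ _ n (trans lhs (sym rhs))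
  where
  M = j ℕ.+ p
  n = suc M
  Y = j ℕ.+ (suc j ℕ.+ p)
  1+n+M≡2n : suc (n ℕ.+ M) ≡ 2 ℕ.* n
  1+n+M≡2n = trans (cong suc (sym (ℕₚ.+-suc M M))) (n+n≡2*n n)
  p+Y≡n+M : p ℕ.+ Y ≡ n ℕ.+ M
  p+Y≡n+M = eq j p
    where
    eq : ∀ j p → p ℕ.+ (j ℕ.+ (suc j ℕ.+ p)) ≡ suc (j ℕ.+ p) ℕ.+ (j ℕ.+ p)
    eq = ℕ-Solver.solve-∀
  lhs : n ℕ.* ((2 ℕ.* n) C n) ℕ.* M ! ℕ.* M ! ℕ.* 1 ℕ.* n ≡ (2 ℕ.* n) !
  lhs = begin
    n ℕ.* ((2 ℕ.* n) C n) ℕ.* M ! ℕ.* M ! ℕ.* 1 ℕ.* n ≡⟨ regroup n ((2 ℕ.* n) C n) (M !) ⟩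
    ((2 ℕ.* n) C n) ℕ.* (n ! ℕ.* n !)                   ≡⟨ kCm*[m!*n!]≡k! n n (n+n≡2*n n) ⟩
    (2 ℕ.* n) !                                          ∎
    where
    regroup : ∀ n c f → n ℕ.* c ℕ.* f ℕ.* f ℕ.* 1 ℕ.* n ≡ c ℕ.* ((n ℕ.* f) ℕ.* (n ℕ.* f))
    regroup = ℕ-Solver.solve-∀
  rhs : 2 ℕ.* ((n ℕ.+ M) C p) ℕ.* (p ! ℕ.* Y !) ℕ.* n ≡ (2 ℕ.* n) !
  rhs = begin
    2 ℕ.* ((n ℕ.+ M) C p) ℕ.* (p ! ℕ.* Y !) ℕ.* n     ≡⟨ regroup ((n ℕ.+ M) C p) (p ! ℕ.* Y !) n ⟩
    (2 ℕ.* n) ℕ.* (((n ℕ.+ M) C p) ℕ.* (p ! ℕ.* Y !)) ≡⟨ cong (2 ℕ.* n ℕ.*_) (kCm*[m!*n!]≡k! p Y p+Y≡n+M) ⟩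
    (2 ℕ.* n) ℕ.* (n ℕ.+ M) !                           ≡⟨ cong (ℕ._* (n ℕ.+ M) !) (sym 1+n+M≡2n) ⟩
    suc (n ℕ.+ M) !                                      ≡⟨ cong _! 1+n+M≡2n ⟩
    (2 ℕ.* n) !                                          ∎
    where
    regroup : ∀ c f n → 2 ℕ.* c ℕ.* f ℕ.* n ≡ (2 ℕ.* n) ℕ.* (c ℕ.* f)
    regroup = ℕ-Solver.solve-∀

rhsColumn-weight : ∀ j p → let M = j ℕ.+ p in
  ι (suc M ℕ.* ((2 ℕ.* suc M) C suc M)) * ((ι (M !) * recip (p !)) * (ι (rising (suc j) p) * factorialRatio (suc j ℕ.+ p) j))
  ≡ ι (2 ℕ.* ((suc M ℕ.+ M) C p))
rhsColumn-weight j p = begin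
  ι A * ((ι (M !) * recip (p !)) * (ι (rising (suc j) p) * (ι (j !) * recip (Y !))))
    ≡⟨ regroup (ι A) (ι (M !)) (recip (p !)) (ι (rising (suc j) p)) (ι (j !)) (recip (Y !)) ⟩
  ι A * ι (M !) * (ι (rising (suc j) p) * ι (j !)) * (recip (p !) * recip (Y !))
    ≡⟨ cong₂ (λ a b → ι A * ι (M !) * a * b)
             (trans (sym (ι-homo-* (rising (suc j) p) (j !))) (cong ι (rising*!≡! j p)))
             (sym (recip-homo-* (p !) (Y !) {{p !≢0}} {{Y !≢0}})) ⟩
  ι A * ι (M !) * ι (M !) * recip (p ! ℕ.* Y !)
    ≡⟨ cong (_* recip (p ! ℕ.* Y !)) (sym (trans (ι-homo-* (A ℕ.* M !) (M !)) (cong (_* ι (M !)) (ι-homo-* A (M !))))) ⟩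
  ι (A ℕ.* M ! ℕ.* M !) * recip (p ! ℕ.* Y !)
    ≡⟨ ι*recip-cross (A ℕ.* M ! ℕ.* M !) (p ! ℕ.* Y !) (2 ℕ.* ((suc M ℕ.+ M) C p)) 1 {{p !* Y !≢0}}
                     (centralBinomial-cleared j p) ⟩
  ι (2 ℕ.* ((suc M ℕ.+ M) C p)) * 1ℚ
    ≡⟨ ℚ.*-identityʳ _ ⟩
  ι (2 ℕ.* ((suc M ℕ.+ M) C p))
    ∎
  where
  open ℕₚ using (_!≢0; _!*_!≢0)
  M = j ℕ.+ p
  A = suc M ℕ.* ((2 ℕ.* suc M) C suc M)
  Y = j ℕ.+ (suc j ℕ.+ p)
  regroup : ∀ a f x r g y → a * ((f * x) * (r * (g * y))) ≡ a * f * (r * g) * (x * y)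
  regroup = solve-∀ ℚ-ring

rhsColumn : ∀ j p {M} → j ℕ.+ p ≡ M → ∀ c →
  ι (suc M ℕ.* ((2 ℕ.* suc M) C suc M)) * Σ< (suc p) (λ i → rhsTerm M (j ℕ.+ i) j * (c ÷ℕ (j ℕ.+ (j ℕ.+ i) ℕ.+ 1)))
  ≡ ι (2 ℕ.* ((suc M ℕ.+ M) C p)) * c
rhsColumn j p refl c = begin
  ι A * Σ< (suc p) (λ i → rhsTerm M (j ℕ.+ i) j * (c ÷ℕ (j ℕ.+ (j ℕ.+ i) ℕ.+ 1)))
    ≡⟨ cong (ι A *_) (Σ<-cong (suc p) (λ i i<1+p → term i (ℕₚ.≤-pred i<1+p))) ⟩
  ι A * Σ< (suc p) (λ i → c * (K * (sgn i * ι (p C i) * factorialRatio (suc j) (j ℕ.+ i))))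
    ≡⟨ cong (ι A *_) (trans (Σ<-*ˡ (suc p) c _) (cong (c *_) (Σ<-*ˡ (suc p) K _))) ⟩
  ι A * (c * (K * alternatingBinomialSum p (λ i → factorialRatio (suc j) (j ℕ.+ i))))
    ≡⟨ cong (λ x → ι A * (c * (K * x))) (alternatingBinomialSum-factorialRatio p (suc j) j) ⟩
  ι A * (c * (K * (ι (rising (suc j) p) * factorialRatio (suc j ℕ.+ p) j)))
    ≡⟨ regroup (ι A) c K _ ⟩
  ι A * (K * (ι (rising (suc j) p) * factorialRatio (suc j ℕ.+ p) j)) * c
    ≡⟨ cong (_* c) (rhsColumn-weight j p) ⟩
  ι (2 ℕ.* ((suc M ℕ.+ M) C p)) * c
    ∎
  where
  M = j ℕ.+ p
  A = suc M ℕ.* ((2 ℕ.* suc M) C suc M)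
  K = ι (M !) * recip (p !)
  regroup : ∀ a c k x → a * (c * (k * x)) ≡ a * (k * x) * c
  regroup = solve-∀ ℚ-ring
  term : ∀ i → i ℕ.≤ p →
    rhsTerm M (j ℕ.+ i) j * (c ÷ℕ (j ℕ.+ (j ℕ.+ i) ℕ.+ 1))
    ≡ c * (K * (sgn i * ι (p C i) * factorialRatio (suc j) (j ℕ.+ i)))
  term i i≤p = begin
    rhsTerm M (j ℕ.+ i) j * (c ÷ℕ e)        ≡⟨ cong (rhsTerm M (j ℕ.+ i) j *_) (÷ℕ≡*recip c e) ⟩
    rhsTerm M (j ℕ.+ i) j * (c * recip e)   ≡⟨ swap (rhsTerm M (j ℕ.+ i) j) c (recip e) ⟩
    c * (rhsTerm M (j ℕ.+ i) j * recip e)   ≡⟨ cong (c *_) reindexed ⟩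
    c * (K * (sgn i * ι (p C i) * factorialRatio (suc j) (j ℕ.+ i))) ∎
    where
    e = j ℕ.+ (j ℕ.+ i) ℕ.+ 1
    swap : ∀ x y z → x * (y * z) ≡ y * (x * z)
    swap = solve-∀ ℚ-ring
    reindexed : rhsTerm M (j ℕ.+ i) j * recip e ≡ K * (sgn i * ι (p C i) * factorialRatio (suc j) (j ℕ.+ i))
    reindexed = rhsTerm-reindexed j i (p ∸ i) (ℕₚ.m+[n∸m]≡n i≤p)

rhsSum-closedForm : ∀ m (f : ℕ → ℚ) →
  ι (suc m ℕ.* ((2 ℕ.* suc m) C suc m)) *
    Σ< (suc m) (λ k → Σ< (suc k) (λ j → rhsTerm m k j * (f j ÷ℕ (j ℕ.+ k ℕ.+ 1))))
  ≡ Σ< (suc m) (λ j → ι (2 ℕ.* ((suc m ℕ.+ m) C (m ∸ j))) * f j)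
rhsSum-closedForm m f = begin
  ι A * Σ< (suc m) (λ k → Σ< (suc k) (g k))                         ≡⟨ cong (ι A *_) (Σ<-triangle (suc m) g) ⟩
  ι A * Σ< (suc m) (λ j → Σ< (suc m ∸ j) (λ i → g (j ℕ.+ i) j))    ≡⟨ sym (Σ<-*ˡ (suc m) (ι A) _) ⟩
  Σ< (suc m) (λ j → ι A * Σ< (suc m ∸ j) (λ i → g (j ℕ.+ i) j))    ≡⟨ Σ<-cong (suc m) (λ j j<1+m → column j (ℕₚ.≤-pred j<1+m)) ⟩
  Σ< (suc m) (λ j → ι (2 ℕ.* ((suc m ℕ.+ m) C (m ∸ j))) * f j)     ∎
  where
  A = suc m ℕ.* ((2 ℕ.* suc m) C suc m)
  g : ℕ → ℕ → ℚ
  g k j = rhsTerm m k j * (f j ÷ℕ (j ℕ.+ k ℕ.+ 1))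
  column : ∀ j → j ℕ.≤ m →
    ι A * Σ< (suc m ∸ j) (λ i → g (j ℕ.+ i) j) ≡ ι (2 ℕ.* ((suc m ℕ.+ m) C (m ∸ j))) * f j
  column j j≤m = trans (cong (λ n → ι A * Σ< n (λ i → g (j ℕ.+ i) j)) (ℕₚ.+-∸-assoc 1 j≤m))
                       (rhsColumn j (m ∸ j) (ℕₚ.m+[n∸m]≡n j≤m) (f j))

0≤ι[t]+½ : ∀ t → 0ℚ ≤ ι t + ½
0≤ι[t]+½ t = ℚ.nonNegative⁻¹ (ι t + ½)
  {{ℚ.nonNeg+nonNeg⇒nonNeg (ι t) {{ℚ.normalize-nonNeg t 1}} ½ {{ℚ.normalize-nonNeg 1 2}}}}

∣[1+m+m]/2-[m∸t]∣≡ι[t]+½ : ∀ m t → t ℕ.≤ m → ∣ + (suc m ℕ.+ m) / 2 - ι (m ∸ t) ∣ ≡ ι t + ½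
∣[1+m+m]/2-[m∸t]∣≡ι[t]+½ m t t≤m = begin
  ∣ + (suc m ℕ.+ m) / 2 - ι (m ∸ t) ∣        ≡⟨ cong (λ x → ∣ x - ι (m ∸ t) ∣) ([1+m+m]/2≡ι[m]+½ m) ⟩
  ∣ ι m + ½ - ι (m ∸ t) ∣                     ≡⟨ cong (λ k → ∣ ι k + ½ - ι (m ∸ t) ∣) (sym (ℕₚ.m∸n+n≡m t≤m)) ⟩
  ∣ ι (m ∸ t ℕ.+ t) + ½ - ι (m ∸ t) ∣         ≡⟨ cong (λ x → ∣ x + ½ - ι (m ∸ t) ∣) (ι-homo-+ (m ∸ t) t) ⟩
  ∣ ι (m ∸ t) + ι t + ½ - ι (m ∸ t) ∣         ≡⟨ cong ∣_∣ (cancel (ι (m ∸ t)) (ι t) ½) ⟩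
  ∣ ι t + ½ ∣                                  ≡⟨ ℚ.0≤p⇒∣p∣≡p (0≤ι[t]+½ t) ⟩
  ι t + ½                                      ∎
  where
  cancel : ∀ a b h → a + b + h - a ≡ b + h
  cancel = solve-∀ ℚ-ring

∣[1+m+m]/2-[1+m+t]∣≡ι[t]+½ : ∀ m t → ∣ + (suc m ℕ.+ m) / 2 - ι (suc m ℕ.+ t) ∣ ≡ ι t + ½
∣[1+m+m]/2-[1+m+t]∣≡ι[t]+½ m t = begin
  ∣ + (suc m ℕ.+ m) / 2 - ι (suc m ℕ.+ t) ∣   ≡⟨ cong (λ x → ∣ x - ι (suc m ℕ.+ t) ∣) ([1+m+m]/2≡ι[m]+½ m) ⟩
  ∣ ι m + ½ - ι (suc m ℕ.+ t) ∣                ≡⟨ cong (λ x → ∣ ι m + ½ - x ∣) (trans (ι-homo-+ (suc m) t) (cong (_+ ι t) (ι-homo-+ 1 m))) ⟩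
  ∣ ι m + ½ - (1ℚ + ι m + ι t) ∣               ≡⟨ cong (λ x → ∣ ι m + ½ - (x + ι m + ι t) ∣) (sym ½+½≡1) ⟩
  ∣ ι m + ½ - (½ + ½ + ι m + ι t) ∣            ≡⟨ cong ∣_∣ (cancel (ι m) (ι t) ½) ⟩
  ∣ - (ι t + ½) ∣                               ≡⟨ ℚ.∣-p∣≡∣p∣ (ι t + ½) ⟩
  ∣ ι t + ½ ∣                                   ≡⟨ ℚ.0≤p⇒∣p∣≡p (0≤ι[t]+½ t) ⟩
  ι t + ½                                       ∎
  where
  cancel : ∀ a b h → a + h - (h + h + a + b) ≡ - (b + h)
  cancel = solve-∀ ℚ-ring

-- The k-th and (2m+1-k)-th terms of U e (2m+1) coincide, and with k = m - j both have |N/2 - k| = j + ½.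
U-odd : ∀ m e → U e (suc m ℕ.+ m) ≡ Σ< (suc m) (λ j → ι (2 ℕ.* ((suc m ℕ.+ m) C (m ∸ j))) * (ι j + ½) ^ e)
U-odd m e = begin
  Σ< (suc N) f                                         ≡⟨ cong (λ n → Σ< n f) (sym (ℕₚ.+-suc (suc m) m)) ⟩
  Σ< (suc m ℕ.+ suc m) f                               ≡⟨ Σ<-split (suc m) (suc m) f ⟩
  Σ< (suc m) f + Σ< (suc m) (λ t → f (suc m ℕ.+ t))    ≡⟨ cong₂ _+_ (trans (Σ<-reverse m f) (Σ<-cong (suc m) lower)) (Σ<-cong (suc m) upper) ⟩
  Σ< (suc m) w + Σ< (suc m) w                          ≡⟨ sym (Σ<-+ (suc m) w w) ⟩
  Σ< (suc m) (λ t → w t + w t)                         ≡⟨ Σ<-cong (suc m) (λ t _ → double t) ⟩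
  Σ< (suc m) (λ t → ι (2 ℕ.* (N C (m ∸ t))) * (ι t + ½) ^ e) ∎
  where
  N = suc m ℕ.+ m
  f w : ℕ → ℚ
  f k = ι (N C k) * (∣ + N / 2 - ι k ∣ ^ e)
  w t = ι (N C (m ∸ t)) * (ι t + ½) ^ e
  lower : ∀ t → t ℕ.< suc m → f (m ∸ t) ≡ w t
  lower t t<1+m = cong (λ x → ι (N C (m ∸ t)) * x ^ e) (∣[1+m+m]/2-[m∸t]∣≡ι[t]+½ m t (ℕₚ.≤-pred t<1+m))
  upper : ∀ t → t ℕ.< suc m → f (suc m ℕ.+ t) ≡ w t
  upper t t<1+m = cong₂ (λ k x → ι k * x ^ e) symmetry (∣[1+m+m]/2-[1+m+t]∣≡ι[t]+½ m t)
    where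
    symmetry : N C (suc m ℕ.+ t) ≡ N C (m ∸ t)
    symmetry = trans (nCk≡nC[n∸k] (ℕₚ.+-monoʳ-≤ (suc m) (ℕₚ.≤-pred t<1+m)))
                     (cong (N C_) (ℕₚ.[m+n]∸[m+o]≡n∸o (suc m) m t))
  double : ∀ t → w t + w t ≡ ι (2 ℕ.* (N C (m ∸ t))) * (ι t + ½) ^ e
  double t = trans (twice (ι (N C (m ∸ t))) ((ι t + ½) ^ e)) (cong (_* (ι t + ½) ^ e) (sym (ι-homo-* 2 (N C (m ∸ t)))))
    where
    twice : ∀ c x → c * x + c * x ≡ (1ℚ + 1ℚ) * c * x
    twice = solve-∀ ℚ-ring

mainTheorem8 : (n : ℕ) → 1 ℕ.≤ n → (r : ℕ) →
    U (2 ℕ.* r ℕ.+ 1) (2 ℕ.* n ∸ 1) ≡ rhsCoeff n r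
mainTheorem8 (suc m) _ r = begin
  U e (2 ℕ.* suc m ∸ 1)                                                    ≡⟨ cong (U e) (2[1+m]∸1≡1+m+m m) ⟩
  U e (suc m ℕ.+ m)                                                         ≡⟨ U-odd m e ⟩
  Σ< (suc m) (λ j → ι (2 ℕ.* ((suc m ℕ.+ m) C (m ∸ j))) * (ι j + ½) ^ e)  ≡⟨ sym (rhsSum-closedForm m (λ j → (ι j + ½) ^ e)) ⟩
  rhsCoeff (suc m) r                                                        ∎
  where
  e = 2 ℕ.* r ℕ.+ 1
  2[1+m]∸1≡1+m+m : ∀ m → m ℕ.+ suc (m ℕ.+ 0) ≡ suc m ℕ.+ m
  2[1+m]∸1≡1+m+m = ℕ-Solver.solve-∀
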